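{- Let $n,m\ge 3$ and let $C_n,C_m$ be cycles on $n$ and $m$ vertices. Let $\Delta$ be the maximum degree of $C_n\times C_m$. Then $\chi''_{\Sigma}(C_n\times C_m)=\Delta+2$.
   Context: All graphs are finite and simple. A proper total $k$-coloring of a graph $G$ assigns to every vertex and every edge a color from $\{1,\dots,k\}$ such that adjacent vertices receive different colors, edges sharing an endpoint receive different colors, and no edge receives the same color as either of its endpoints. For such a coloring $c$ and a vertex $v$, let $f(v)=c(v)+\sum_{e\ni v} c(e)$. The coloring distinguishes adjacent vertices by sums if $f(u)\neq f(v)$ for every edge $uv$. $\chi''_{\Sigma}(G)$ denotes the smallest $k$ such that $G$ has a proper total $k$-coloring distinguishing adjacent vertices by sums. The product $G_1\times G_2$ is the Cartesian product: vertex set $V(G_1)\times V(G_2)$, with $(u_1,u_2)$ adjacent to $(v_1,v_2)$ iff either $u_1=v_1$ and $u_2v_2\in E(G_2)$, or $u_1v_1\in E(G_1)$ and $u_2=v_2$. -}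

module Defs where

open import Data.Nat using (ℕ; zero; suc; _+_; _*_; _≤_; _⊔_; _%_)
open import Data.Nat.Properties using (_≟_)
open import Data.Nat.ListAction using (sum)
open import Data.Bool using (Bool; true; false; if_then_else_; _∨_; _∧_)
open import Data.Fin using (Fin; toℕ; remQuot)
open import Data.List using (List; map; foldr)
open import Data.List.Base using (allFin)
open import Data.Product using (Σ; ∃; _×_; _,_; proj₁; proj₂)
open import Relation.Nullary using (¬_)
open import Relation.Nullary.Decidable using (⌊_⌋)
open import Relation.Binary.PropositionalEquality using (_≡_)
import Data.Fin.Properties as FinP

-- A finite graph on vertex set Fin N given by a Boolean adjacency function
-- (all graphs used below are simple: adjacency is symmetric and irreflexive).
record Graph : Set where
  field
    N   : ℕ
    adj : Fin N → Fin N → Bool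

open Graph public

Adj : (G : Graph) → Fin (N G) → Fin (N G) → Set
Adj G u v = adj G u v ≡ true

sumFin : (n : ℕ) → (Fin n → ℕ) → ℕ
sumFin n f = sum (map f (allFin n))

degree : (G : Graph) → Fin (N G) → ℕ
degree G v = sumFin (N G) (λ u → if adj G v u then 1 else 0)

maxDegree : (G : Graph) → ℕ
maxDegree G = foldr _⊔_ 0 (map (degree G) (allFin (N G)))

cycle : ℕ → Graph
cycle zero = record { N = zero ; adj = λ () }
cycle (suc k) = record
  { N = suc k
  ; adj = λ i j → ⌊ toℕ j ≟ suc (toℕ i) % suc k ⌋ ∨ ⌊ toℕ i ≟ suc (toℕ j) % suc k ⌋ }

-- Cartesian product; vertex (a , b) of G₁ × G₂ is encoded as combine a b : Fin (N G₁ * N G₂)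
_□_ : Graph → Graph → Graph
G₁ □ G₂ = record
  { N = N G₁ * N G₂
  ; adj = λ x y → prodAdj (remQuot (N G₂) x) (remQuot (N G₂) y) }
  where
  prodAdj : Fin (N G₁) × Fin (N G₂) → Fin (N G₁) × Fin (N G₂) → Bool
  prodAdj (u₁ , u₂) (v₁ , v₂) =
    (⌊ u₁ FinP.≟ v₁ ⌋ ∧ adj G₂ u₂ v₂) ∨ (adj G₁ u₁ v₁ ∧ ⌊ u₂ FinP.≟ v₂ ⌋)

-- vertex colours vc v, edge colours ec u v (meaningful for adjacent u v only)
record TotalColoring (G : Graph) (k : ℕ) : Set where
  field
    vc : Fin (N G) → ℕ
    ec : Fin (N G) → Fin (N G) → ℕ
    vc-range : ∀ v → 1 ≤ vc v × vc v ≤ k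
    ec-range : ∀ u v → Adj G u v → 1 ≤ ec u v × ec u v ≤ k
    ec-sym   : ∀ u v → Adj G u v → ec u v ≡ ec v u
    vv-proper : ∀ u v → Adj G u v → ¬ (vc u ≡ vc v)
    ee-proper : ∀ v u w → Adj G v u → Adj G v w → ¬ (u ≡ w) → ¬ (ec v u ≡ ec v w)
    ve-proper : ∀ u v → Adj G u v → ¬ (ec u v ≡ vc u)

weight : {G : Graph} {k : ℕ} → TotalColoring G k → Fin (N G) → ℕ
weight {G} c v = TotalColoring.vc c v
  + sumFin (N G) (λ u → if adj G v u then TotalColoring.ec c v u else 0)

SumDistinguishing : {G : Graph} {k : ℕ} → TotalColoring G k → Set
SumDistinguishing {G} c = ∀ u v → Adj G u v → ¬ (weight c u ≡ weight c v)

HasSumDistTotalColoring : Graph → ℕ → Set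
HasSumDistTotalColoring G k = Σ (TotalColoring G k) SumDistinguishing

ChiSigma≡ : Graph → ℕ → Set
ChiSigma≡ G k = HasSumDistTotalColoring G k × (∀ j → HasSumDistTotalColoring G j → k ≤ j)

-- Every vertex of C_n □ C_m has degree 4. With at most 5 colors, a vertex and its four edges
-- carry five distinct colors from {1,…,5}, so every vertex has weight 15 and no edge is
-- distinguished; hence at least 6 colors are needed. For 6 colors, each cycle is labelled by a
-- closed walk in the digraph ℓ₀ → ℓ₁ → ℓ₀, ℓ₁ → ℓ₂ → ℓ₀ (ℓ₀ ℓ₁ repeated, closed by ℓ₂ when the
-- length is odd). The colors of a vertex and of its edges are read off fixed tables from the
-- labels around it, so properness and the distinctness of adjacent weights only depend on a few
-- consecutive labels in each coordinate; these finitely many configurations are checked by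
-- evaluation.

module Submission where

open import Defs
open import Data.Bool using (Bool; true; false; if_then_else_; _∨_; _∧_)
open import Data.Bool.Properties as Bool using (∨-zeroʳ)
open import Data.Fin as Fin using (Fin; zero; suc; toℕ; fromℕ; inject₁; combine; remQuot)
open import Data.Fin.Properties
  using (toℕ-injective; toℕ-fromℕ; toℕ-inject₁; toℕ<n; suc-injective;
         remQuot-combine; combine-remQuot; combine-injective)
open import Data.Fin.Relation.Unary.Top using (view; ‵fromℕ; ‵inj₁; view-fromℕ; view-inject₁)
open import Data.List using (List; []; _∷_; _++_; map; filter; foldr; length; applyUpTo; allFin; tabulate)
open import Data.List.Properties using (length-map; length-applyUpTo; map-cong; map-∘)
open import Data.List.Membership.Propositional using (_∈_; _∉_)
open import Data.List.Membership.Propositional.Properties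
  using (∈-filter⁺; ∈-filter⁻; ∈-allFin; ∈-map⁺; ∈-map⁻; ∈-∃++; ∈-++⁻; ∈-++⁺ˡ; ∈-++⁺ʳ; ∈-applyUpTo⁺)
open import Data.List.Membership.Propositional.Properties.WithK using (unique∧set⇒bag)
open import Data.List.Relation.Binary.BagAndSetEquality using (∼bag⇒↭)
open import Data.List.Relation.Binary.Subset.Propositional using (_⊆_)
open import Data.List.Relation.Binary.Permutation.Propositional
  using (_↭_; ↭-refl; ↭-prep; ↭-trans; ↭-sym; ↭⇒↭ₛ; module PermutationReasoning)
open import Data.List.Relation.Binary.Permutation.Propositional.Properties
  using (shift; ↭-length; All-resp-↭) renaming (map⁺ to ↭-map⁺)
import Data.List.Relation.Binary.Permutation.Setoid.Properties as Permutationₛ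
open import Data.List.Relation.Unary.All as All using (All; []; _∷_; all?)
open import Data.List.Relation.Unary.All.Properties using () renaming (map⁺ to All-map⁺; map⁻ to All-map⁻)
open import Data.List.Relation.Unary.AllPairs as AllPairs using ([]; _∷_)
open import Data.List.Relation.Unary.Any using (here; there)
open import Data.List.Relation.Unary.Unique.Propositional using (Unique)
import Data.List.Relation.Unary.Unique.Propositional.Properties as Unique
open import Data.Nat using (ℕ; zero; suc; _+_; _%_; _⊔_; _≤_; s≤s)
open import Data.Nat.Properties as ℕ using (≤-reflexive; ≤-trans; ≤-pred; _≤?_; ≰⇒>; ⊔-identityʳ; ⊔-idem)
open import Data.Nat.DivMod using (n%n≡0; m<n⇒m%n≡m)
open import Data.Nat.ListAction using (sum)
open import Data.Nat.ListAction.Properties using (sum-↭)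
open import Data.List.Relation.Unary.Unique.DecPropositional ℕ._≟_ using (unique?)
open import Data.Product using (∃₂; _×_; _,_; proj₁; proj₂; uncurry)
open import Data.Product.Properties using (×-≡,≡→≡)
open import Data.Sum using (_⊎_; inj₁; inj₂)
open import Function using (_∘_; mk⇔)
open import Relation.Nullary using (Dec; yes; no; ¬_; contradiction)
open import Relation.Nullary.Decidable using (⌊_⌋; map′; _×-dec_; _→-dec_; from-yes; ¬?)
open import Relation.Unary using (Decidable)
open import Relation.Binary.PropositionalEquality
  using (_≡_; _≢_; ≢-sym; refl; sym; trans; cong; cong₂; subst; subst₂; setoid; module ≡-Reasoning)

private
  variable
    A B : Set
    x y : A
    xs ys : List A

InRange : ℕ → ℕ → Set
InRange k x = 1 ≤ x × x ≤ k

∈-applyUpTo-suc : ∀ {k x} → InRange k x → x ∈ applyUpTo suc k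
∈-applyUpTo-suc {x = suc i} (_ , i<k) = ∈-applyUpTo⁺ suc i<k

Unique-resp-↭ : ∀ {A : Set} {xs ys : List A} → xs ↭ ys → Unique xs → Unique ys
Unique-resp-↭ {A} p = Permutationₛ.Unique-resp-↭ (setoid A) (↭⇒↭ₛ p)

module _ {f : A → B} where

  injectiveOn⇒Unique-map : (∀ {x y} → x ∈ xs → y ∈ xs → x ≢ y → f x ≢ f y) → Unique xs → Unique (map f xs)
  injectiveOn⇒Unique-map f≢ [] = []
  injectiveOn⇒Unique-map f≢ (x≢xs ∷ u) =
    All-map⁺ (All.tabulate λ y∈xs → f≢ (here refl) (there y∈xs) (All.lookup x≢xs y∈xs))
    ∷ injectiveOn⇒Unique-map (λ x∈ y∈ → f≢ (there x∈) (there y∈)) u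

  Unique-map⇒injectiveOn : Unique (map f xs) → x ∈ xs → y ∈ xs → x ≢ y → f x ≢ f y
  Unique-map⇒injectiveOn {xs = _ ∷ _} _ (here refl) (here refl) x≢y = contradiction refl x≢y
  Unique-map⇒injectiveOn {xs = _ ∷ _} (fx≢ ∷ _) (here refl) (there y∈) _ = All.lookup (All-map⁻ fx≢) y∈
  Unique-map⇒injectiveOn {xs = _ ∷ _} (fy≢ ∷ _) (there x∈) (here refl) _ = ≢-sym (All.lookup (All-map⁻ fy≢) x∈)
  Unique-map⇒injectiveOn {xs = _ ∷ _} (_ ∷ u) (there x∈) (there y∈) x≢y = Unique-map⇒injectiveOn u x∈ y∈ x≢y

∷⊆⇒split : x ∉ xs → x ∷ xs ⊆ ys → ∃₂ λ as bs → ys ≡ as ++ x ∷ bs × xs ⊆ as ++ bs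
∷⊆⇒split {x = x} x∉xs sub with as , bs , refl ← ∈-∃++ (sub (here refl)) = as , bs , refl , skip
  where
  skip : _ ⊆ as ++ bs
  skip z∈xs with ∈-++⁻ as (sub (there z∈xs))
  ... | inj₁ z∈as = ∈-++⁺ˡ z∈as
  ... | inj₂ (here refl) = contradiction z∈xs x∉xs
  ... | inj₂ (there z∈bs) = ∈-++⁺ʳ as z∈bs

Unique-⊆⇒↭ : Unique xs → xs ⊆ ys → length ys ≤ length xs → xs ↭ ys
Unique-⊆⇒↭ {ys = []} [] _ _ = ↭-refl
Unique-⊆⇒↭ {xs = x ∷ _} u@(_ ∷ u′) sub len
  with as , bs , refl , sub′ ← ∷⊆⇒split (Unique.Unique[x∷xs]⇒x∉xs u) sub =
  ↭-trans (↭-prep x (Unique-⊆⇒↭ u′ sub′ (≤-pred (subst (_≤ _) (↭-length (shift x as bs)) len))))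
          (↭-sym (shift x as bs))

sum-map-if : (p : A → Bool) (f : A → ℕ) (xs : List A) →
  sum (map (λ x → if p x then f x else 0) xs) ≡ sum (map f (filter (λ x → p x Bool.≟ true) xs))
sum-map-if p f [] = refl
sum-map-if p f (x ∷ xs) with p x
... | true = cong (f x +_) (sum-map-if p f xs)
... | false = sum-map-if p f xs

sum-map-1≡length : (xs : List A) → sum (map (λ _ → 1) xs) ≡ length xs
sum-map-1≡length [] = refl
sum-map-1≡length (_ ∷ xs) = cong suc (sum-map-1≡length xs)

foldr-⊔-map-const : ∀ {f : A → ℕ} {d} → (∀ x → f x ≡ d) → ∀ x xs → foldr _⊔_ 0 (map f (x ∷ xs)) ≡ d
foldr-⊔-map-const f≡d x [] = trans (⊔-identityʳ _) (f≡d x)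
foldr-⊔-map-const {d = d} f≡d x (y ∷ ys) = trans (cong₂ _⊔_ (f≡d x) (foldr-⊔-map-const f≡d y ys)) (⊔-idem d)

isYes-true : (a? : Dec A) → A → ⌊ a? ⌋ ≡ true
isYes-true (yes _) _ = refl
isYes-true (no ¬a) a = contradiction a ¬a

isYes-false : (a? : Dec A) → ¬ A → ⌊ a? ⌋ ≡ false
isYes-false (yes a) ¬a = contradiction a ¬a
isYes-false (no _) _ = refl

isYes-true⁻ : (a? : Dec A) → ⌊ a? ⌋ ≡ true → A
isYes-true⁻ (yes a) _ = a

∨-trueˡ : ∀ {x y} → x ≡ true → x ∨ y ≡ true
∨-trueˡ refl = refl

∨-trueʳ : ∀ {x y} → y ≡ true → x ∨ y ≡ true
∨-trueʳ {x} refl = ∨-zeroʳ x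

∨-true⁻ : ∀ {x y} → x ∨ y ≡ true → x ≡ true ⊎ y ≡ true
∨-true⁻ {true} _ = inj₁ refl
∨-true⁻ {false} e = inj₂ e

∧-true⁻ : ∀ {x y} → x ∧ y ≡ true → x ≡ true × y ≡ true
∧-true⁻ {true} e = refl , e

module _ (G : Graph) where

  neighbours : Fin (N G) → List (Fin (N G))
  neighbours v = filter (λ u → adj G v u Bool.≟ true) (allFin (N G))

  ∈-neighbours⁺ : ∀ {u v} → Adj G v u → u ∈ neighbours v
  ∈-neighbours⁺ = ∈-filter⁺ _ (∈-allFin _)

  ∈-neighbours⁻ : ∀ {u v} → u ∈ neighbours v → Adj G v u
  ∈-neighbours⁻ {v = v} = proj₂ ∘ ∈-filter⁻ (λ u → adj G v u Bool.≟ true) {xs = allFin (N G)}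

  neighbours-unique : ∀ v → Unique (neighbours v)
  neighbours-unique v = Unique.filter⁺ _ (Unique.allFin⁺ (N G))

  degree≡length-neighbours : ∀ v → degree G v ≡ length (neighbours v)
  degree≡length-neighbours v = trans (sum-map-if (adj G v) _ (allFin (N G))) (sum-map-1≡length (neighbours v))

module _ {G : Graph} {k : ℕ} (c : TotalColoring G k) where
  open TotalColoring c

  colors : Fin (N G) → List ℕ
  colors v = vc v ∷ map (ec v) (neighbours G v)

  weight≡sum-colors : ∀ v → weight c v ≡ sum (colors v)
  weight≡sum-colors v = cong (vc v +_) (sum-map-if (adj G v) (ec v) (allFin (N G)))

  length-colors : ∀ v → length (colors v) ≡ suc (degree G v)
  length-colors v = cong suc (trans (length-map (ec v) (neighbours G v)) (sym (degree≡length-neighbours G v)))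

  colors-unique : ∀ v → Unique (colors v)
  colors-unique v =
    All-map⁺ (All.tabulate λ u∈ → ≢-sym (ve-proper v _ (∈-neighbours⁻ G u∈)))
    ∷ injectiveOn⇒Unique-map (λ u∈ w∈ → ee-proper v _ _ (∈-neighbours⁻ G u∈) (∈-neighbours⁻ G w∈))
                             (neighbours-unique G v)

  colors-inRange : ∀ v → All (InRange k) (colors v)
  colors-inRange v = vc-range v ∷ All-map⁺ (All.tabulate λ u∈ → ec-range v _ (∈-neighbours⁻ G u∈))

  ≤1+degree⇒weight≡ : ∀ v → k ≤ suc (degree G v) → weight c v ≡ sum (applyUpTo suc (suc (degree G v)))
  ≤1+degree⇒weight≡ v k≤ = trans (weight≡sum-colors v) (sum-↭ (Unique-⊆⇒↭ (colors-unique v) ⊆range len))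
    where
    ⊆range : colors v ⊆ applyUpTo suc (suc (degree G v))
    ⊆range c∈ = let (1≤ , ≤k) = All.lookup (colors-inRange v) c∈ in ∈-applyUpTo-suc (1≤ , ≤-trans ≤k k≤)
    len : length (applyUpTo suc (suc (degree G v))) ≤ length (colors v)
    len = ≤-reflexive (trans (length-applyUpTo suc _) (sym (length-colors v)))

HasSumDist⇒2+degree≤ : ∀ {G k u v} → Adj G u v → degree G u ≡ degree G v →
  HasSumDistTotalColoring G k → 2 + degree G u ≤ k
HasSumDist⇒2+degree≤ {G} {k} {u} {v} uv deg≡ (c , distinguishes) with k ≤? suc (degree G u)
... | no k≰ = ≰⇒> k≰
... | yes k≤ = contradiction equal (distinguishes u v uv)
  where
  open ≡-Reasoning
  equal : weight c u ≡ weight c v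
  equal = begin
    weight c u                               ≡⟨ ≤1+degree⇒weight≡ c u k≤ ⟩
    sum (applyUpTo suc (suc (degree G u)))   ≡⟨ cong (λ d → sum (applyUpTo suc (suc d))) deg≡ ⟩
    sum (applyUpTo suc (suc (degree G v)))   ≡⟨ ≤1+degree⇒weight≡ c v (subst (λ d → k ≤ suc d) deg≡ k≤) ⟨
    weight c v                               ∎

module _ {G : Graph} (k : ℕ) (vc : Fin (N G) → ℕ) (ec : Fin (N G) → Fin (N G) → ℕ) where

  localTotalColoring :
    (∀ u v → Adj G u v → ec u v ≡ ec v u) →
    (∀ u v → Adj G u v → vc u ≢ vc v) →
    (∀ v → Unique (vc v ∷ map (ec v) (neighbours G v))) →
    (∀ v → All (InRange k) (vc v ∷ map (ec v) (neighbours G v))) →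
    TotalColoring G k
  localTotalColoring ec-sym vv-proper unique inRange = record
    { vc = vc
    ; ec = ec
    ; vc-range = λ v → All.head (inRange v)
    ; ec-range = λ u v uv → All.lookup (All-map⁻ (All.tail (inRange u))) (∈-neighbours⁺ G uv)
    ; ec-sym = ec-sym
    ; vv-proper = vv-proper
    ; ee-proper = λ v u w vu vw u≢w →
        Unique-map⇒injectiveOn (AllPairs.tail (unique v)) (∈-neighbours⁺ G vu) (∈-neighbours⁺ G vw) u≢w
    ; ve-proper = λ u v uv →
        ≢-sym (All.lookup (All-map⁻ (AllPairs.head (unique u))) (∈-neighbours⁺ G uv))
    }

-- Cartesian products

module ProductGraph (G H : Graph) where

  Pair : Set
  Pair = Fin (N G) × Fin (N H)

  vertex : Pair → Fin (N (G □ H))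
  vertex = uncurry combine

  coords : Fin (N (G □ H)) → Pair
  coords = remQuot (N H)

  ProductAdj : Pair → Pair → Set
  ProductAdj (a , b) (c , d) = (a ≡ c × Adj H b d) ⊎ (Adj G a c × b ≡ d)

  adjᵇ : Pair → Pair → Bool
  adjᵇ (a , b) (c , d) = (⌊ a Fin.≟ c ⌋ ∧ adj H b d) ∨ (adj G a c ∧ ⌊ b Fin.≟ d ⌋)

  adjᵇ-true⁺ : ∀ {p q} → ProductAdj p q → adjᵇ p q ≡ true
  adjᵇ-true⁺ {a , _} (inj₁ (refl , e)) = ∨-trueˡ (cong₂ _∧_ (isYes-true (a Fin.≟ a) refl) e)
  adjᵇ-true⁺ {_ , b} (inj₂ (e , refl)) = ∨-trueʳ (cong₂ _∧_ e (isYes-true (b Fin.≟ b) refl))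

  adjᵇ-true⁻ : ∀ {p q} → adjᵇ p q ≡ true → ProductAdj p q
  adjᵇ-true⁻ {a , b} {c , d} e with ∨-true⁻ e
  ... | inj₁ e₁ = let (a≡c , bd) = ∧-true⁻ e₁ in inj₁ (isYes-true⁻ (a Fin.≟ c) a≡c , bd)
  ... | inj₂ e₂ = let (ac , b≡d) = ∧-true⁻ e₂ in inj₂ (ac , isYes-true⁻ (b Fin.≟ d) b≡d)

  Adj-□⁺ : ∀ {p q} → ProductAdj p q → Adj (G □ H) (vertex p) (vertex q)
  Adj-□⁺ {a , b} {c , d} pq =
    subst₂ (λ p′ q′ → adjᵇ p′ q′ ≡ true) (sym (remQuot-combine a b)) (sym (remQuot-combine c d)) (adjᵇ-true⁺ pq)

  Adj-□⁻ : ∀ {x y} → Adj (G □ H) x y → ProductAdj (coords x) (coords y)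
  Adj-□⁻ = adjᵇ-true⁻

  vertex-coords : ∀ x → vertex (coords x) ≡ x
  vertex-coords = combine-remQuot {N G} (N H)

  vertex-injective : ∀ {p q} → vertex p ≡ vertex q → p ≡ q
  vertex-injective {a , b} {c , d} eq = ×-≡,≡→≡ (combine-injective a b c d eq)

-- Cycles labelled by closed walks

data Label : Set where
  ℓ₀ ℓ₁ ℓ₂ : Label

data Step : Label → Label → Set where
  s01 : Step ℓ₀ ℓ₁
  s10 : Step ℓ₁ ℓ₀
  s12 : Step ℓ₁ ℓ₂
  s20 : Step ℓ₂ ℓ₀

record LabelledCycles (G : Graph) : Set where
  field
    next prev : Fin (N G) → Fin (N G)
    next-prev : ∀ i → next (prev i) ≡ i
    prev-next : ∀ i → prev (next i) ≡ i
    next≢prev : ∀ i → next i ≢ prev i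
    adj-next  : ∀ i → Adj G i (next i)
    adj-prev  : ∀ i → Adj G i (prev i)
    adj⇒      : ∀ {i j} → Adj G i j → j ≡ next i ⊎ j ≡ prev i
    label     : Fin (N G) → Label
    step      : ∀ i → Step (label (prev i)) (label i)

  next≢id : ∀ i → next i ≢ i
  next≢id i eq = next≢prev i (trans eq (sym (trans (cong prev (sym eq)) (prev-next i))))

  prev≢id : ∀ i → prev i ≢ i
  prev≢id i eq = next≢id (prev i) (trans (next-prev i) (sym eq))

  next²≢id : ∀ i → next (next i) ≢ i
  next²≢id i eq = next≢prev (next i) (trans eq (sym (prev-next i)))

  step⁺ : ∀ i → Step (label i) (label (next i))
  step⁺ i = subst (λ j → Step (label j) (label (next i))) (prev-next i) (step (next i))

module CycleOrder {k : ℕ} where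

  prev : Fin (suc k) → Fin (suc k)
  prev zero = fromℕ k
  prev (suc i) = inject₁ i

  next : Fin (suc k) → Fin (suc k)
  next i with view i
  ... | ‵fromℕ = zero
  ... | ‵inj₁ {i = j} _ = suc j

  next-prev : ∀ i → next (prev i) ≡ i
  next-prev zero rewrite view-fromℕ k = refl
  next-prev (suc i) rewrite view-inject₁ i = refl

  prev-next : ∀ i → prev (next i) ≡ i
  prev-next i with view i
  ... | ‵fromℕ = refl
  ... | ‵inj₁ _ = refl

  toℕ-next : ∀ i → toℕ (next i) ≡ suc (toℕ i) % suc k
  toℕ-next i with view i
  ... | ‵fromℕ rewrite toℕ-fromℕ k = sym (n%n≡0 (suc k))
  ... | ‵inj₁ {i = j} _ rewrite toℕ-inject₁ j = sym (m<n⇒m%n≡m (s≤s (toℕ<n j)))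

  Adj-next : ∀ i → Adj (cycle (suc k)) i (next i)
  Adj-next i = ∨-trueˡ (isYes-true (toℕ (next i) ℕ.≟ suc (toℕ i) % suc k) (toℕ-next i))

  Adj-prev : ∀ i → Adj (cycle (suc k)) i (prev i)
  Adj-prev i = ∨-trueʳ (isYes-true (toℕ i ℕ.≟ suc (toℕ (prev i)) % suc k)
                                   (trans (cong toℕ (sym (next-prev i))) (toℕ-next (prev i))))

  Adj⇒ : ∀ {i j} → Adj (cycle (suc k)) i j → j ≡ next i ⊎ j ≡ prev i
  Adj⇒ {i} {j} e with toℕ j ℕ.≟ suc (toℕ i) % suc k | toℕ i ℕ.≟ suc (toℕ j) % suc k
  ... | yes p | _ = inj₁ (toℕ-injective (trans p (sym (toℕ-next i))))
  ... | no _ | yes q =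
    inj₂ (trans (sym (prev-next j)) (cong prev (sym (toℕ-injective (trans q (sym (toℕ-next j)))))))
  ... | no _ | no _ with () ← e

prev²≢id : ∀ {k} (i : Fin (3 + k)) → CycleOrder.prev (CycleOrder.prev i) ≢ i
prev²≢id zero ()
prev²≢id (suc zero) ()
prev²≢id (suc (suc i)) = inject₁²≢suc² i
  where
  inject₁²≢suc² : ∀ {n} (j : Fin n) → inject₁ (inject₁ j) ≢ suc (suc j)
  inject₁²≢suc² zero ()
  inject₁²≢suc² (suc j) eq = inject₁²≢suc² j (suc-injective eq)

cycleLabel : ∀ k → Fin (2 + k) → Label
cycleLabel 0 zero = ℓ₀
cycleLabel 0 (suc zero) = ℓ₁
cycleLabel 1 zero = ℓ₀
cycleLabel 1 (suc zero) = ℓ₁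
cycleLabel 1 (suc (suc zero)) = ℓ₂
cycleLabel (suc (suc k)) zero = ℓ₀
cycleLabel (suc (suc k)) (suc zero) = ℓ₁
cycleLabel (suc (suc k)) (suc (suc i)) = cycleLabel k i

cycleLabel-zero : ∀ k → cycleLabel k zero ≡ ℓ₀
cycleLabel-zero 0 = refl
cycleLabel-zero 1 = refl
cycleLabel-zero (suc (suc k)) = refl

cycleLabel-step : ∀ k (i : Fin (2 + k)) → Step (cycleLabel k (CycleOrder.prev i)) (cycleLabel k i)
cycleLabel-step 0 zero = s10
cycleLabel-step 0 (suc zero) = s01
cycleLabel-step 1 zero = s20
cycleLabel-step 1 (suc zero) = s01
cycleLabel-step 1 (suc (suc zero)) = s12
cycleLabel-step (suc (suc k)) zero = subst (Step _) (cycleLabel-zero k) (cycleLabel-step k zero)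
cycleLabel-step (suc (suc k)) (suc zero) = s01
cycleLabel-step (suc (suc k)) (suc (suc zero)) = subst (Step ℓ₁) (sym (cycleLabel-zero k)) s10
cycleLabel-step (suc (suc k)) (suc (suc (suc i))) = cycleLabel-step k (suc i)

labelledCycle : ∀ k → LabelledCycles (cycle (3 + k))
labelledCycle k = record
  { next = next
  ; prev = prev
  ; next-prev = next-prev
  ; prev-next = prev-next
  ; next≢prev = λ i eq → prev²≢id i (trans (cong prev (sym eq)) (prev-next i))
  ; adj-next = Adj-next
  ; adj-prev = Adj-prev
  ; adj⇒ = Adj⇒
  ; label = cycleLabel (suc k)
  ; step = cycleLabel-step (suc k)
  }
  where open CycleOrder

-- Color tables

step? : ∀ s t → Dec (Step s t)
step? ℓ₀ ℓ₁ = yes s01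
step? ℓ₁ ℓ₀ = yes s10
step? ℓ₁ ℓ₂ = yes s12
step? ℓ₂ ℓ₀ = yes s20
step? ℓ₀ ℓ₀ = no λ ()
step? ℓ₀ ℓ₂ = no λ ()
step? ℓ₁ ℓ₁ = no λ ()
step? ℓ₂ ℓ₁ = no λ ()
step? ℓ₂ ℓ₂ = no λ ()

∀-Label? : ∀ {p} {P : Label → Set p} → Decidable P → Dec (∀ t → P t)
∀-Label? P? = map′ (λ { (p₀ , p₁ , p₂) → λ { ℓ₀ → p₀ ; ℓ₁ → p₁ ; ℓ₂ → p₂ } })
                   (λ h → h ℓ₀ , h ℓ₁ , h ℓ₂)
                   (P? ℓ₀ ×-dec P? ℓ₁ ×-dec P? ℓ₂)

vertexTable : Label → Label → ℕ
vertexTable ℓ₀ ℓ₀ = 3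
vertexTable ℓ₀ ℓ₁ = 4
vertexTable ℓ₀ ℓ₂ = 1
vertexTable ℓ₁ ℓ₀ = 6
vertexTable ℓ₁ ℓ₁ = 3
vertexTable ℓ₁ ℓ₂ = 2
vertexTable ℓ₂ ℓ₀ = 2
vertexTable ℓ₂ ℓ₁ = 5
vertexTable ℓ₂ ℓ₂ = 3

-- In both edge tables only entries whose last two labels form a Step are ever used; the
-- remaining entries are junk.
edgeTable₂ : Label → Label → Label → ℕ
edgeTable₂ ℓ₀ ℓ₀ ℓ₁ = 2
edgeTable₂ ℓ₀ ℓ₁ ℓ₀ = 5
edgeTable₂ ℓ₀ ℓ₁ ℓ₂ = 3
edgeTable₂ ℓ₀ ℓ₂ ℓ₀ = 5
edgeTable₂ ℓ₁ ℓ₀ ℓ₁ = 2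
edgeTable₂ ℓ₁ ℓ₁ ℓ₀ = 5
edgeTable₂ ℓ₁ ℓ₁ ℓ₂ = 5
edgeTable₂ ℓ₁ ℓ₂ ℓ₀ = 3
edgeTable₂ ℓ₂ ℓ₀ ℓ₁ = 3
edgeTable₂ ℓ₂ ℓ₁ ℓ₀ = 1
edgeTable₂ ℓ₂ ℓ₁ ℓ₂ = 1
edgeTable₂ ℓ₂ ℓ₂ ℓ₀ = 5
edgeTable₂ _ _ _ = 0

edgeTable₁ : Label → Label → Label → ℕ
edgeTable₁ ℓ₀ ℓ₀ ℓ₁ = 1
edgeTable₁ ℓ₀ ℓ₁ ℓ₀ = 4
edgeTable₁ ℓ₀ ℓ₁ ℓ₂ = 4
edgeTable₁ ℓ₀ ℓ₂ ℓ₀ = 6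
edgeTable₁ ℓ₁ ℓ₀ ℓ₁ = 1
edgeTable₁ ℓ₁ ℓ₁ ℓ₀ = 6
edgeTable₁ ℓ₁ ℓ₁ ℓ₂ = 4
edgeTable₁ ℓ₁ ℓ₂ ℓ₀ = 6
edgeTable₁ ℓ₂ ℓ₀ ℓ₁ = 4
edgeTable₁ ℓ₂ ℓ₁ ℓ₀ = 6
edgeTable₁ ℓ₂ ℓ₁ ℓ₂ = 6
edgeTable₁ ℓ₂ ℓ₂ ℓ₀ = 2
edgeTable₁ _ _ _ = 0

-- The colors at a vertex whose coordinates see the labels t₋ t t₊ and s₋ s s₊ at their
-- predecessor, themselves and their successor: the vertex, then its edges in the two
-- directions of the second coordinate, then in the two directions of the first.
localColors : Label → Label → Label → Label → Label → Label → List ℕ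
localColors t₋ t t₊ s₋ s s₊ =
  vertexTable t s ∷ edgeTable₂ t s s₊ ∷ edgeTable₂ t s₋ s ∷ edgeTable₁ s t t₊ ∷ edgeTable₁ s t₋ t ∷ []

localColors-proper : ∀ t₋ t t₊ s₋ s s₊ → Step t₋ t → Step t t₊ → Step s₋ s → Step s s₊ →
  Unique (localColors t₋ t t₊ s₋ s s₊) × All (InRange 6) (localColors t₋ t t₊ s₋ s s₊)
localColors-proper = from-yes
  (∀-Label? λ t₋ → ∀-Label? λ t → ∀-Label? λ t₊ → ∀-Label? λ s₋ → ∀-Label? λ s → ∀-Label? λ s₊ →
   step? t₋ t →-dec step? t t₊ →-dec step? s₋ s →-dec step? s s₊ →-dec
   (unique? (localColors t₋ t t₊ s₋ s s₊) ×-dec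
    all? (λ x → (1 ≤? x) ×-dec (x ≤? 6)) (localColors t₋ t t₊ s₋ s s₊)))

vertexTable-proper₂ : ∀ t s s′ → Step s s′ → vertexTable t s ≢ vertexTable t s′
vertexTable-proper₂ = from-yes
  (∀-Label? λ t → ∀-Label? λ s → ∀-Label? λ s′ →
   step? s s′ →-dec ¬? (vertexTable t s ℕ.≟ vertexTable t s′))

vertexTable-proper₁ : ∀ t t′ s → Step t t′ → vertexTable t s ≢ vertexTable t′ s
vertexTable-proper₁ = from-yes
  (∀-Label? λ t → ∀-Label? λ t′ → ∀-Label? λ s →
   step? t t′ →-dec ¬? (vertexTable t s ℕ.≟ vertexTable t′ s))

localWeight-distinct₂ : ∀ t₋ t t₊ s₀ s₁ s₂ s₃ →
  Step t₋ t → Step t t₊ → Step s₀ s₁ → Step s₁ s₂ → Step s₂ s₃ →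
  sum (localColors t₋ t t₊ s₀ s₁ s₂) ≢ sum (localColors t₋ t t₊ s₁ s₂ s₃)
localWeight-distinct₂ = from-yes
  (∀-Label? λ t₋ → ∀-Label? λ t → ∀-Label? λ t₊ → ∀-Label? λ s₀ → ∀-Label? λ s₁ → ∀-Label? λ s₂ → ∀-Label? λ s₃ →
   step? t₋ t →-dec step? t t₊ →-dec step? s₀ s₁ →-dec step? s₁ s₂ →-dec step? s₂ s₃ →-dec
   ¬? (sum (localColors t₋ t t₊ s₀ s₁ s₂) ℕ.≟ sum (localColors t₋ t t₊ s₁ s₂ s₃)))

localWeight-distinct₁ : ∀ t₀ t₁ t₂ t₃ s₋ s s₊ →
  Step t₀ t₁ → Step t₁ t₂ → Step t₂ t₃ → Step s₋ s → Step s s₊ →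
  sum (localColors t₀ t₁ t₂ s₋ s s₊) ≢ sum (localColors t₁ t₂ t₃ s₋ s s₊)
localWeight-distinct₁ = from-yes
  (∀-Label? λ t₀ → ∀-Label? λ t₁ → ∀-Label? λ t₂ → ∀-Label? λ t₃ → ∀-Label? λ s₋ → ∀-Label? λ s → ∀-Label? λ s₊ →
   step? t₀ t₁ →-dec step? t₁ t₂ →-dec step? t₂ t₃ →-dec step? s₋ s →-dec step? s s₊ →-dec
   ¬? (sum (localColors t₀ t₁ t₂ s₋ s s₊) ℕ.≟ sum (localColors t₁ t₂ t₃ s₋ s s₊)))

-- A sum-distinguishing 6-coloring of a product of labelled cycles

module LabelledProduct {G H : Graph} (L₁ : LabelledCycles G) (L₂ : LabelledCycles H) where
  module A = LabelledCycles L₁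
  module B = LabelledCycles L₂
  open ProductGraph G H public

  around : Pair → List Pair
  around (a , b) = (a , B.next b) ∷ (a , B.prev b) ∷ (A.next a , b) ∷ (A.prev a , b) ∷ []

  ProductAdj⇒∈around : ∀ {p q} → ProductAdj p q → q ∈ around p
  ProductAdj⇒∈around (inj₁ (refl , e)) with B.adj⇒ e
  ... | inj₁ refl = here refl
  ... | inj₂ refl = there (here refl)
  ProductAdj⇒∈around (inj₂ (e , refl)) with A.adj⇒ e
  ... | inj₁ refl = there (there (here refl))
  ... | inj₂ refl = there (there (there (here refl)))

  ∈around⇒ProductAdj : ∀ {p q} → q ∈ around p → ProductAdj p q
  ∈around⇒ProductAdj {a , b} (here refl) = inj₁ (refl , B.adj-next b)
  ∈around⇒ProductAdj {a , b} (there (here refl)) = inj₁ (refl , B.adj-prev b)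
  ∈around⇒ProductAdj {a , b} (there (there (here refl))) = inj₂ (A.adj-next a , refl)
  ∈around⇒ProductAdj {a , b} (there (there (there (here refl)))) = inj₂ (A.adj-prev a , refl)

  Adj⇒∈around : ∀ {x y} → Adj (G □ H) x y → coords y ∈ around (coords x)
  Adj⇒∈around = ProductAdj⇒∈around ∘ Adj-□⁻

  ∈around⇒Adj : ∀ {p q} → q ∈ around p → Adj (G □ H) (vertex p) (vertex q)
  ∈around⇒Adj = Adj-□⁺ ∘ ∈around⇒ProductAdj

  around-unique : ∀ p → Unique (around p)
  around-unique (a , b) =
    (B.next≢prev b ∘ cong proj₂ ∷ A.next≢id a ∘ sym ∘ cong proj₁ ∷ A.prev≢id a ∘ sym ∘ cong proj₁ ∷ [])
    ∷ (A.next≢id a ∘ sym ∘ cong proj₁ ∷ A.prev≢id a ∘ sym ∘ cong proj₁ ∷ [])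
    ∷ (A.next≢prev a ∘ cong proj₁ ∷ [])
    ∷ []
    ∷ []

  neighbours-□ : ∀ x → map vertex (around (coords x)) ↭ neighbours (G □ H) x
  neighbours-□ x = ∼bag⇒↭ (unique∧set⇒bag (Unique.map⁺ vertex-injective (around-unique (coords x)))
                                           (neighbours-unique (G □ H) x)
                                           (mk⇔ to from))
    where
    to : ∀ {y} → y ∈ map vertex (around (coords x)) → y ∈ neighbours (G □ H) x
    to y∈ with q , q∈ , refl ← ∈-map⁻ vertex y∈ =
      ∈-neighbours⁺ (G □ H) (subst (λ x′ → Adj (G □ H) x′ (vertex q)) (vertex-coords x) (∈around⇒Adj q∈))
    from : ∀ {y} → y ∈ neighbours (G □ H) x → y ∈ map vertex (around (coords x))
    from {y} y∈ = subst (_∈ _) (vertex-coords y) (∈-map⁺ vertex (Adj⇒∈around (∈-neighbours⁻ (G □ H) y∈)))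

  degree-□ : ∀ x → degree (G □ H) x ≡ 4
  degree-□ x = trans (degree≡length-neighbours (G □ H) x) (sym (↭-length (neighbours-□ x)))

  symmetric-forward⇒around : (R : Pair → Pair → Set) → (∀ {p q} → R p q → R q p) →
    (∀ a b → R (a , b) (a , B.next b)) → (∀ a b → R (a , b) (A.next a , b)) →
    ∀ {p q} → q ∈ around p → R p q
  symmetric-forward⇒around R sym-R R₂ R₁ {a , b} (here refl) = R₂ a b
  symmetric-forward⇒around R sym-R R₂ R₁ {a , b} (there (here refl)) =
    sym-R (subst (λ z → R (a , B.prev b) (a , z)) (B.next-prev b) (R₂ a (B.prev b)))
  symmetric-forward⇒around R sym-R R₂ R₁ {a , b} (there (there (here refl))) = R₁ a b
  symmetric-forward⇒around R sym-R R₂ R₁ {a , b} (there (there (there (here refl)))) =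
    sym-R (subst (λ z → R (A.prev a , b) (z , b)) (A.next-prev a) (R₁ (A.prev a) b))

  edgeColor₂ : Fin (N G) → Fin (N H) → ℕ
  edgeColor₂ a b = edgeTable₂ (A.label a) (B.label b) (B.label (B.next b))

  edgeColor₁ : Fin (N G) → Fin (N H) → ℕ
  edgeColor₁ a b = edgeTable₁ (B.label b) (A.label a) (A.label (A.next a))

  vertexColor : Pair → ℕ
  vertexColor (a , b) = vertexTable (A.label a) (B.label b)

  -- An edge is colored from the endpoint whose successor is the other endpoint.
  edgeColor : Pair → Pair → ℕ
  edgeColor (a , b) (c , d) =
    if ⌊ a Fin.≟ c ⌋ then (if ⌊ d Fin.≟ B.next b ⌋ then edgeColor₂ a b else edgeColor₂ a d)
                     else (if ⌊ c Fin.≟ A.next a ⌋ then edgeColor₁ a b else edgeColor₁ c b)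

  edgeColor-next₂ : ∀ a b → edgeColor (a , b) (a , B.next b) ≡ edgeColor₂ a b
  edgeColor-next₂ a b rewrite isYes-true (a Fin.≟ a) refl | isYes-true (B.next b Fin.≟ B.next b) refl = refl

  edgeColor-next₂′ : ∀ a b → edgeColor (a , B.next b) (a , b) ≡ edgeColor₂ a b
  edgeColor-next₂′ a b
    rewrite isYes-true (a Fin.≟ a) refl | isYes-false (b Fin.≟ B.next (B.next b)) (≢-sym (B.next²≢id b)) = refl

  edgeColor-prev₂ : ∀ a b → edgeColor (a , b) (a , B.prev b) ≡ edgeColor₂ a (B.prev b)
  edgeColor-prev₂ a b
    rewrite isYes-true (a Fin.≟ a) refl | isYes-false (B.prev b Fin.≟ B.next b) (≢-sym (B.next≢prev b)) = refl

  edgeColor-next₁ : ∀ a b → edgeColor (a , b) (A.next a , b) ≡ edgeColor₁ a b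
  edgeColor-next₁ a b
    rewrite isYes-false (a Fin.≟ A.next a) (≢-sym (A.next≢id a)) | isYes-true (A.next a Fin.≟ A.next a) refl = refl

  edgeColor-next₁′ : ∀ a b → edgeColor (A.next a , b) (a , b) ≡ edgeColor₁ a b
  edgeColor-next₁′ a b
    rewrite isYes-false (A.next a Fin.≟ a) (A.next≢id a)
          | isYes-false (a Fin.≟ A.next (A.next a)) (≢-sym (A.next²≢id a)) = refl

  edgeColor-prev₁ : ∀ a b → edgeColor (a , b) (A.prev a , b) ≡ edgeColor₁ (A.prev a) b
  edgeColor-prev₁ a b
    rewrite isYes-false (a Fin.≟ A.prev a) (≢-sym (A.prev≢id a))
          | isYes-false (A.prev a Fin.≟ A.next a) (≢-sym (A.next≢prev a)) = refl

  edgeColor-sym : ∀ {p q} → q ∈ around p → edgeColor p q ≡ edgeColor q p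
  edgeColor-sym = symmetric-forward⇒around (λ p q → edgeColor p q ≡ edgeColor q p) sym
    (λ a b → trans (edgeColor-next₂ a b) (sym (edgeColor-next₂′ a b)))
    (λ a b → trans (edgeColor-next₁ a b) (sym (edgeColor-next₁′ a b)))

  vertexColor-proper : ∀ {p q} → q ∈ around p → vertexColor p ≢ vertexColor q
  vertexColor-proper = symmetric-forward⇒around (λ p q → vertexColor p ≢ vertexColor q) ≢-sym
    (λ a b → vertexTable-proper₂ _ _ _ (B.step⁺ b))
    (λ a b → vertexTable-proper₁ _ _ _ (A.step⁺ a))

  windowColors : Pair → List ℕ
  windowColors (a , b) = localColors (A.label (A.prev a)) (A.label a) (A.label (A.next a))
                                     (B.label (B.prev b)) (B.label b) (B.label (B.next b))

  colors-around : ∀ p → vertexColor p ∷ map (edgeColor p) (around p) ≡ windowColors p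
  colors-around (a , b)
    rewrite edgeColor-next₂ a b | edgeColor-prev₂ a b | edgeColor-next₁ a b | edgeColor-prev₁ a b
          | B.next-prev b | A.next-prev a = refl

  windowColors-proper : ∀ p → Unique (windowColors p) × All (InRange 6) (windowColors p)
  windowColors-proper (a , b) = localColors-proper _ _ _ _ _ _ (A.step a) (A.step⁺ a) (B.step b) (B.step⁺ b)

  windowWeight : Pair → ℕ
  windowWeight p = sum (windowColors p)

  windowWeight-next₂ : ∀ a b → windowWeight (a , b) ≢ windowWeight (a , B.next b)
  windowWeight-next₂ a b rewrite B.prev-next b =
    localWeight-distinct₂ _ _ _ _ _ _ _ (A.step a) (A.step⁺ a) (B.step b) (B.step⁺ b) (B.step⁺ (B.next b))

  windowWeight-next₁ : ∀ a b → windowWeight (a , b) ≢ windowWeight (A.next a , b)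
  windowWeight-next₁ a b rewrite A.prev-next a =
    localWeight-distinct₁ _ _ _ _ _ _ _ (A.step a) (A.step⁺ a) (A.step⁺ (A.next a)) (B.step b) (B.step⁺ b)

  windowWeight-proper : ∀ {p q} → q ∈ around p → windowWeight p ≢ windowWeight q
  windowWeight-proper =
    symmetric-forward⇒around (λ p q → windowWeight p ≢ windowWeight q) ≢-sym windowWeight-next₂ windowWeight-next₁

  vc : Fin (N (G □ H)) → ℕ
  vc x = vertexColor (coords x)

  ec : Fin (N (G □ H)) → Fin (N (G □ H)) → ℕ
  ec x y = edgeColor (coords x) (coords y)

  colors↭windowColors : ∀ x → vc x ∷ map (ec x) (neighbours (G □ H) x) ↭ windowColors (coords x)
  colors↭windowColors x = begin
    vc x ∷ map (ec x) (neighbours (G □ H) x)      ↭⟨ ↭-prep (vc x) (↭-map⁺ (ec x) (↭-sym (neighbours-□ x))) ⟩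
    vc x ∷ map (ec x) (map vertex (around p))     ≡⟨ cong (vc x ∷_) (trans (sym (map-∘ {g = ec x} {f = vertex} (around p)))
                                                                           (map-cong ec-vertex (around p))) ⟩
    vertexColor p ∷ map (edgeColor p) (around p)  ≡⟨ colors-around p ⟩
    windowColors p                                ∎
    where
    open PermutationReasoning
    p = coords x
    ec-vertex : ∀ q → ec x (vertex q) ≡ edgeColor p q
    ec-vertex (c , d) = cong (edgeColor p) (remQuot-combine c d)

  coloring : TotalColoring (G □ H) 6
  coloring = localTotalColoring 6 vc ec
    (λ _ _ xy → edgeColor-sym (Adj⇒∈around xy))
    (λ _ _ xy → vertexColor-proper (Adj⇒∈around xy))
    (λ x → Unique-resp-↭ (↭-sym (colors↭windowColors x)) (proj₁ (windowColors-proper (coords x))))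
    (λ x → All-resp-↭ (↭-sym (colors↭windowColors x)) (proj₂ (windowColors-proper (coords x))))

  weight≡windowWeight : ∀ x → weight coloring x ≡ windowWeight (coords x)
  weight≡windowWeight x = trans (weight≡sum-colors coloring x) (sum-↭ (colors↭windowColors x))

  coloring-distinguishes : SumDistinguishing coloring
  coloring-distinguishes x y xy eq =
    windowWeight-proper (Adj⇒∈around xy) (trans (sym (weight≡windowWeight x)) (trans eq (weight≡windowWeight y)))

theorem4p8 : (n m : ℕ) → 3 ≤ n → 3 ≤ m →
    ChiSigma≡ (cycle n □ cycle m) (maxDegree (cycle n □ cycle m) + 2)
theorem4p8 (suc (suc (suc k))) (suc (suc (suc l))) (s≤s (s≤s (s≤s _))) (s≤s (s≤s (s≤s _))) =
  subst (λ Δ → ChiSigma≡ G (Δ + 2)) (sym maxDegree≡4) ((coloring , coloring-distinguishes) , atLeast6)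
  where
  open LabelledProduct (labelledCycle k) (labelledCycle l)
  G : Graph
  G = cycle (3 + k) □ cycle (3 + l)
  maxDegree≡4 : maxDegree G ≡ 4
  maxDegree≡4 = foldr-⊔-map-const degree-□ zero (tabulate suc)
  p₀ q₀ : Pair
  p₀ = zero , zero
  q₀ = zero , B.next zero
  atLeast6 : ∀ j → HasSumDistTotalColoring G j → 6 ≤ j
  atLeast6 j = subst (λ d → 2 + d ≤ j) (degree-□ (vertex p₀))
             ∘ HasSumDist⇒2+degree≤ {G} {j} {vertex p₀} {vertex q₀} (∈around⇒Adj {p₀} {q₀} (here refl))
                 (trans (degree-□ (vertex p₀)) (sym (degree-□ (vertex q₀))))
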